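{- Let $H=(V,E')$ be a min-cost degree-constrained subgraph of $G$ with $l(v)=1$ and $u(v)=t$ for all $v$, let $\mathcal C^*=\{C_1^*,\dots,C_k^*\}$ be a fixed optimal $(t,k)$-fair clustering, and let $\hat{\mathcal C}=\{\hat C_1,\dots,\hat C_\kappa\}$ be the merged clustering. Define the clustering $\mathcal C'=\{C_1',\dots,C_\kappa'\}$ of $\Omega'$ by putting each star $S$ of $H$ into $C_i'$, where $\hat C_i$ is the cluster of $\hat{\mathcal C}$ containing all vertices of $S$. Then $\mathrm{cost}_{(\Omega',d')}(\mathcal C')\le 2\cdot \mathrm{cost}_{(\Omega,d)}(\hat{\mathcal C})$.
   Context: Setting: disjoint finite sets $P_1$ (red) and $P_2$ (blue), a metric $d$ on $\Omega=P_1\cup P_2$, integers $k>0$, $t\ge1$. A $(t,k)$-fair clustering is a partition of $\Omega$ into at most $k$ clusters, each cluster $X$ satisfying $\frac1t|X\cap P_2|\le|X\cap P_1|\le t|X\cap P_2|$; it is optimal if it minimizes the sum of radii $r(Q)=\min_{p\in\Omega}\max_{q\in Q}d(p,q)$ among such clusterings. $G=(V,E)$ is the complete bipartite graph with $V=P_1\cup P_2$ and $E=\{\{p,q\}:p\in P_1,q\in P_2\}$, edge weight $w(\{p,q\})=d(p,q)$. A degree-constrained subgraph (DCS) with bounds $l,u$ is a spanning subgraph in which every vertex $v$ has degree in $[l(v),u(v)]$; a min-cost DCS minimizes the total edge weight among all DCS. Such an $H$ is a vertex-disjoint union of stars; the stars of $H$ are its connected components (viewed as vertex sets). Merged clustering: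 start with $\hat{\mathcal C}=\mathcal C^*$; while some edge $\{p,q\}\in E'$ has $p$ and $q$ in different clusters of $\hat{\mathcal C}$, replace those two clusters by their union; $\hat{\mathcal C}$ is the final result (every star lies inside one of its clusters). Build an edge-weighted graph $G'$ whose vertices are the points of $\Omega$ together with one vertex for each star $S$ of $H$; for all $p,q\in\Omega$ add edge $\{p,q\}$ of weight $d(p,q)$, and for all $p\in\Omega$ and stars $S$ add edge $\{p,S\}$ of weight $\max_{q\in S}d(p,q)$. Let $d'$ be the shortest-path metric of $G'$ and $\Omega'$ the set of star vertices. For a clustering $\mathcal D$ and a set of candidate centers $S_1$ with metric $d_1$, $\mathrm{cost}_{(S_1,d_1)}(\mathcal D)=\sum_{Q\in\mathcal D}\min_{p\in S_1}\max_{q\in Q}d_1(p,q)$.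
   Formalization: The metric d on Ω takes rational values, so the edge weights of G and G′, the metric d′ and the costs are rational as well. -}

module Defs where

open import Data.Nat as ℕ using (ℕ; zero; suc)
open import Data.Bool using (Bool; true; false; if_then_else_; _∨_)
open import Data.Fin using (Fin; zero; suc; _≟_)
open import Data.Sum using (_⊎_; inj₁; inj₂)
open import Data.Product using (Σ; ∃; _×_; _,_)
open import Data.Rational as ℚ using (ℚ; 0ℚ)
open import Relation.Nullary.Decidable using (⌊_⌋)
open import Relation.Binary.PropositionalEquality using (_≡_)
open import Relation.Binary.Construct.Closure.ReflexiveTransitive using (Star)

sumℚ : (n : ℕ) → (Fin n → ℚ) → ℚ
sumℚ zero    f = 0ℚ
sumℚ (suc n) f = f zero ℚ.+ sumℚ n (λ i → f (suc i))

sumℕ : (n : ℕ) → (Fin n → ℕ) → ℕ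
sumℕ zero    f = 0
sumℕ (suc n) f = f zero ℕ.+ sumℕ n (λ i → f (suc i))

count : (n : ℕ) → (Fin n → Bool) → ℕ
count n P = sumℕ n (λ i → if P i then 1 else 0)

-- max { f i | i < n, P i = true }, with value 0 on the empty set
-- (all values this is applied to are non-negative distances, so this is
--  the true maximum on non-empty sets, and 0 = max over the empty set)
maxOver : (n : ℕ) → (Fin n → Bool) → (Fin n → ℚ) → ℚ
maxOver zero    P f = 0ℚ
maxOver (suc n) P f =
  (if P zero then f zero else 0ℚ) ℚ.⊔ maxOver n (λ i → P (suc i)) (λ i → f (suc i))

-- min { f i | i < n }  (n ≥ 1 whenever it matters; value 0 for n = 0)
minOver : (n : ℕ) → (Fin n → ℚ) → ℚ
minOver zero          f = 0ℚ
minOver (suc zero)    f = f zero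
minOver (suc (suc n)) f = f zero ℚ.⊓ minOver (suc n) (λ i → f (suc i))

record IsMetric {n : ℕ} (d : Fin n → Fin n → ℚ) : Set where
  field
    zero⇔eq : ∀ p q → (d p q ≡ 0ℚ → p ≡ q) × (p ≡ q → d p q ≡ 0ℚ)
    sym     : ∀ p q → d p q ≡ d q p
    tri     : ∀ p q r → d p r ℚ.≤ d p q ℚ.+ d q r

-- A clustering of a set Fin n into (at most) κ clusters is a labelling
-- lab : Fin n → Fin κ; its clusters are the non-empty fibres.
inCluster : {n κ : ℕ} → (Fin n → Fin κ) → Fin κ → Fin n → Bool
inCluster lab i q = ⌊ lab q ≟ i ⌋

-- cost_{(S₁,d₁)}(D) = Σ_{Q ∈ D} min_{p ∈ S₁} max_{q ∈ Q} d₁(p,q)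
-- (points of the clustered set are identified with elements of S₁ = Fin n;
--  empty fibres contribute 0, i.e. they are not clusters)
cost : {n κ : ℕ} → (d₁ : Fin n → Fin n → ℚ) → (Fin n → Fin κ) → ℚ
cost {n} {κ} d₁ lab =
  sumℚ κ (λ i → minOver n (λ p → maxOver n (inCluster lab i) (λ q → d₁ p q)))

-- colouring: red p = true  iff  p ∈ P₁ (red), otherwise p ∈ P₂ (blue)
redCount blueCount : {n κ : ℕ} → (Fin n → Bool) → (Fin n → Fin κ) → Fin κ → ℕ
redCount  {n} red lab i = count n (λ q → inCluster lab i q Data.Bool.∧ red q)
blueCount {n} red lab i = count n (λ q → inCluster lab i q Data.Bool.∧ Data.Bool.not (red q))

-- (t,k)-fair clustering: at most k clusters, each cluster X with
--   (1/t)|X ∩ P₂| ≤ |X ∩ P₁| ≤ t |X ∩ P₂|   (multiplied through by t ≥ 1)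
IsFair : {n : ℕ} → (red : Fin n → Bool) → (t k : ℕ) → (Fin n → Fin k) → Set
IsFair red t k lab =
  ∀ i → (blueCount red lab i ℕ.≤ t ℕ.* redCount red lab i)
      × (redCount red lab i ℕ.≤ t ℕ.* blueCount red lab i)

IsOptimalFair : {n : ℕ} → (Fin n → Fin n → ℚ) → (Fin n → Bool) → (t k : ℕ)
              → (Fin n → Fin k) → Set
IsOptimalFair d red t k lab =
  IsFair red t k lab × (∀ (lab′ : Fin _ → Fin k) → IsFair red t k lab′ → cost d lab ℚ.≤ cost d lab′)

-- Subgraphs of the complete bipartite graph G between P₁ and P₂.
-- A subgraph is given by h : Fin n → Fin n → Bool, where h p q = true means
-- that the edge {p,q} (p red, q blue) is present.

IsBipSubgraph : {n : ℕ} → (Fin n → Bool) → (Fin n → Fin n → Bool) → Set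
IsBipSubgraph red h = ∀ p q → h p q ≡ true → (red p ≡ true) × (red q ≡ false)

degree : {n : ℕ} → (Fin n → Fin n → Bool) → Fin n → ℕ
degree {n} h v = count n (λ q → h v q ∨ h q v)

weight : {n : ℕ} → (Fin n → Fin n → ℚ) → (Fin n → Fin n → Bool) → ℚ
weight {n} d h = sumℚ n (λ p → sumℚ n (λ q → if h p q then d p q else 0ℚ))

IsDCS : {n : ℕ} → (Fin n → Bool) → ℕ → (Fin n → Fin n → Bool) → Set
IsDCS red t h = IsBipSubgraph red h × (∀ v → (1 ℕ.≤ degree h v) × (degree h v ℕ.≤ t))

IsMinCostDCS : {n : ℕ} → (Fin n → Fin n → ℚ) → (Fin n → Bool) → ℕ
             → (Fin n → Fin n → Bool) → Set
IsMinCostDCS d red t h =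
  IsDCS red t h × (∀ h′ → IsDCS red t h′ → weight d h ℚ.≤ weight d h′)

Adj : {n : ℕ} → (Fin n → Fin n → Bool) → Fin n → Fin n → Set
Adj h p q = (h p q ≡ true) ⊎ (h q p ≡ true)

Conn : {n : ℕ} → (Fin n → Fin n → Bool) → Fin n → Fin n → Set
Conn h = Star (Adj h)

-- σ : Fin n → Fin m enumerates the stars (components) of H:
-- σ p is the star containing p; every star index is used.
IsStarEnum : {n m : ℕ} → (Fin n → Fin n → Bool) → (Fin n → Fin m) → Set
IsStarEnum h σ =
  (∀ p q → (σ p ≡ σ q → Conn h p q) × (Conn h p q → σ p ≡ σ q))
  × (∀ s → ∃ λ p → σ p ≡ s)

-- Merged clustering: the result of repeatedly merging clusters of C* joined by
-- an edge of H is the partition whose classes are the classes of the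
-- equivalence relation generated by "same cluster of C*" and "adjacent in H".
-- μ : Fin n → Fin κ enumerates these classes (every index used).
MergeRel : {n k : ℕ} → (Fin n → Fin k) → (Fin n → Fin n → Bool) → Fin n → Fin n → Set
MergeRel cstar h p q = (cstar p ≡ cstar q) ⊎ Adj h p q

IsMerged : {n k κ : ℕ} → (Fin n → Fin k) → (Fin n → Fin n → Bool) → (Fin n → Fin κ) → Set
IsMerged cstar h μ =
  (∀ p q → (μ p ≡ μ q → Star (MergeRel cstar h) p q)
         × (Star (MergeRel cstar h) p q → μ p ≡ μ q))
  × (∀ i → ∃ λ p → μ p ≡ i)

-- The graph G′: vertices Ω ⊎ Ω′ (Ω′ = Fin m, the stars), edges
--   {p,q}  (p,q ∈ Ω)  of weight d(p,q),
--   {p,S}  (p ∈ Ω, S star) of weight max_{q ∈ S} d(p,q);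
-- no edges between two star vertices.

module GraphG′ {n m : ℕ} (d : Fin n → Fin n → ℚ) (σ : Fin n → Fin m) where

  V′ : Set
  V′ = Fin n ⊎ Fin m

  starW : Fin n → Fin m → ℚ
  starW p S = maxOver n (inCluster σ S) (λ q → d p q)

  data Walk : V′ → V′ → Set where
    []   : ∀ {x} → Walk x x
    pp   : ∀ {y} (p q : Fin n) → Walk (inj₁ q) y → Walk (inj₁ p) y
    pS   : ∀ {y} (p : Fin n) (S : Fin m) → Walk (inj₂ S) y → Walk (inj₁ p) y
    Sp   : ∀ {y} (S : Fin m) (p : Fin n) → Walk (inj₁ p) y → Walk (inj₂ S) y

  len : ∀ {x y} → Walk x y → ℚ
  len []          = 0ℚ
  len (pp p q w)  = d p q ℚ.+ len w
  len (pS p S w)  = starW p S ℚ.+ len w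
  len (Sp S p w)  = starW p S ℚ.+ len w

  IsShortestPath : (V′ → V′ → ℚ) → Set
  IsShortestPath d′ =
    ∀ x y → (∀ (w : Walk x y) → d′ x y ℚ.≤ len w) × (∃ λ (w : Walk x y) → len w ≡ d′ x y)

{-# OPTIONS --safe #-}
-- Let c be an optimal centre of a merged cluster Ĉᵢ and S₀ any star inside
-- Ĉᵢ.  Every star T inside Ĉᵢ is joined to S₀ by the walk S₀ – c – T in G′,
-- whose two edges have weight max_{q ∈ S₀} d(c,q) and max_{q ∈ T} d(c,q), both
-- at most r(Ĉᵢ).  So S₀ is a centre of C′ᵢ with radius ≤ 2 r(Ĉᵢ); summing over
-- i gives the bound.
module Submission where

open import Defs
open import Data.Nat using (ℕ; _≤_; zero; suc)
open import Data.Bool using (Bool; true; false; if_then_else_)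
open import Data.Fin using (Fin; zero; suc; _≟_)
open import Data.Sum using (inj₁; inj₂)
open import Data.Product using (∃; _,_; proj₁; proj₂)
open import Data.Integer using (+_)
open import Data.Rational using (ℚ; _/_; _*_; _+_; 0ℚ; 1ℚ)
  renaming (_≤_ to _≤ℚ_)
open import Data.Rational.Properties
  using (≤-refl; ≤-trans; p≤p⊔q; p≤q⇒p≤r⊔q; ⊔-lub; p⊓q≤p; p⊓q≤q; ⊓-sel; +-mono-≤;
         +-identityʳ; *-identityˡ; *-zeroʳ; *-distribˡ-+; *-distribʳ-+; module ≤-Reasoning)
open import Relation.Binary.PropositionalEquality
  using (_≡_; refl; sym; trans; cong; cong₂; subst)
open import Relation.Nullary using (yes; no; contradiction)

≡⇒inCluster : ∀ {n κ} (lab : Fin n → Fin κ) {i q} → lab q ≡ i → inCluster lab i q ≡ true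
≡⇒inCluster lab {i} {q} eq with lab q ≟ i
... | yes _  = refl
... | no neq = contradiction eq neq

inCluster⇒≡ : ∀ {n κ} (lab : Fin n → Fin κ) {i q} → inCluster lab i q ≡ true → lab q ≡ i
inCluster⇒≡ lab {i} {q} _  with lab q ≟ i
inCluster⇒≡ lab         _  | yes eq = eq
inCluster⇒≡ lab         () | no _

0≤maxOver : ∀ n P f → 0ℚ ≤ℚ maxOver n P f
0≤maxOver zero    P f = ≤-refl
0≤maxOver (suc n) P f =
  p≤q⇒p≤r⊔q (if P zero then f zero else 0ℚ) (0≤maxOver n (λ i → P (suc i)) (λ i → f (suc i)))

maxOver-upperBound : ∀ n P f {q} → P q ≡ true → f q ≤ℚ maxOver n P f
maxOver-upperBound (suc n) P f {zero}  Pq rewrite Pq = p≤p⊔q _ _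
maxOver-upperBound (suc n) P f {suc q} Pq =
  p≤q⇒p≤r⊔q (if P zero then f zero else 0ℚ)
    (maxOver-upperBound n (λ i → P (suc i)) (λ i → f (suc i)) Pq)

-- A bound must be non-negative because the maximum of an empty family is 0.
maxOver-least : ∀ n P f {b} → 0ℚ ≤ℚ b → (∀ q → P q ≡ true → f q ≤ℚ b) → maxOver n P f ≤ℚ b
maxOver-least zero    P f 0≤b bound = 0≤b
maxOver-least (suc n) P f 0≤b bound =
  ⊔-lub head (maxOver-least n (λ i → P (suc i)) (λ i → f (suc i)) 0≤b (λ q → bound (suc q)))
  where
  head : (if P zero then f zero else 0ℚ) ≤ℚ _
  head with P zero in Pzero
  ... | true  = bound zero Pzero
  ... | false = 0≤b

maxOver-mono-⊆ : ∀ n {P R} f → (∀ q → P q ≡ true → R q ≡ true) → maxOver n P f ≤ℚ maxOver n R f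
maxOver-mono-⊆ n {R = R} f P⊆R =
  maxOver-least n _ f (0≤maxOver n R f) (λ q Pq → maxOver-upperBound n R f (P⊆R q Pq))

minOver-lowerBound : ∀ n g (j : Fin n) → minOver n g ≤ℚ g j
minOver-lowerBound (suc zero)    g zero    = ≤-refl
minOver-lowerBound (suc (suc n)) g zero    = p⊓q≤p _ _
minOver-lowerBound (suc (suc n)) g (suc j) =
  ≤-trans (p⊓q≤q (g zero) _) (minOver-lowerBound (suc n) (λ i → g (suc i)) j)

minOver-attained : ∀ n g → Fin n → ∃ λ c → minOver n g ≡ g c
minOver-attained (suc zero)    g _ = zero , refl
minOver-attained (suc (suc n)) g _
  with ⊓-sel (g zero) (minOver (suc n) (λ i → g (suc i)))
     | minOver-attained (suc n) (λ i → g (suc i)) zero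
... | inj₁ eq | _        = zero , eq
... | inj₂ eq | c , eq′  = suc c , trans eq eq′

sumℚ-mono-≤ : ∀ n {f g} → (∀ i → f i ≤ℚ g i) → sumℚ n f ≤ℚ sumℚ n g
sumℚ-mono-≤ zero    f≤g = ≤-refl
sumℚ-mono-≤ (suc n) f≤g = +-mono-≤ (f≤g zero) (sumℚ-mono-≤ n (λ i → f≤g (suc i)))

sumℚ-*-distribˡ : ∀ n a f → sumℚ n (λ i → a * f i) ≡ a * sumℚ n f
sumℚ-*-distribˡ zero    a f = sym (*-zeroʳ a)
sumℚ-*-distribˡ (suc n) a f =
  trans (cong (λ s → a * f zero + s) (sumℚ-*-distribˡ n a (λ i → f (suc i))))
        (sym (*-distribˡ-+ a (f zero) _))

p+p≡2*p : ∀ p → p + p ≡ (+ 2 / 1) * p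
p+p≡2*p p = trans (sym (cong₂ _+_ (*-identityˡ p) (*-identityˡ p))) (sym (*-distribʳ-+ p 1ℚ 1ℚ))

-- The paper's r(Q), with Q given by its characteristic function; cost d₁ lab
-- unfolds to Σᵢ radius d₁ (inCluster lab i).
radius : ∀ {n} → (Fin n → Fin n → ℚ) → (Fin n → Bool) → ℚ
radius {n} d₁ P = minOver n (λ p → maxOver n P (d₁ p))

module _ {n m : ℕ} (d : Fin n → Fin n → ℚ) (σ : Fin n → Fin m) where
  open GraphG′ d σ

  d′-stars≤starW+starW : ∀ {d′} → IsShortestPath d′ →
                         ∀ S T c → d′ (inj₂ S) (inj₂ T) ≤ℚ starW c S + starW c T
  d′-stars≤starW+starW sp S T c =
    subst (_ ≤ℚ_) (cong (λ s → starW c S + s) (+-identityʳ (starW c T)))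
      (proj₁ (sp (inj₂ S) (inj₂ T)) (Sp S c (pS c T [])))

  module _ {κ} {μ : Fin n → Fin κ} {ν : Fin m → Fin κ} (νσ≡μ : ∀ p → ν (σ p) ≡ μ p) where

    starW≤eccentricity : ∀ {i T} → ν T ≡ i → ∀ c →
                         starW c T ≤ℚ maxOver n (inCluster μ i) (d c)
    starW≤eccentricity νT≡i c = maxOver-mono-⊆ n (d c) λ q q∈T →
      ≡⇒inCluster μ (trans (sym (νσ≡μ q))
                    (trans (cong ν (inCluster⇒≡ σ q∈T)) νT≡i))

    radius-stars≤2*radius : ∀ {d′} → IsShortestPath d′ → ∀ {i p₀} → μ p₀ ≡ i →
      radius (λ S T → d′ (inj₂ S) (inj₂ T)) (inCluster ν i)
        ≤ℚ (+ 2 / 1) * radius d (inCluster μ i)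
    radius-stars≤2*radius {d′} sp {i} {p₀} μp₀≡i
      with c , radius≡ecc ← minOver-attained n (λ p → maxOver n (inCluster μ i) (d p)) p₀ =
      begin
        radius (λ S T → d′ (inj₂ S) (inj₂ T)) (inCluster ν i)
          ≤⟨ minOver-lowerBound m _ S₀ ⟩
        maxOver m (inCluster ν i) (λ T → d′ (inj₂ S₀) (inj₂ T))
          ≤⟨ maxOver-least m _ _ (+-mono-≤ (0≤maxOver n _ _) (0≤maxOver n _ _)) via-c ⟩
        ecc + ecc
          ≡⟨ p+p≡2*p ecc ⟩
        (+ 2 / 1) * ecc
          ≡⟨ cong ((+ 2 / 1) *_) radius≡ecc ⟨
        (+ 2 / 1) * radius d (inCluster μ i)
      ∎
      where
      open ≤-Reasoning
      S₀ = σ p₀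
      ecc = maxOver n (inCluster μ i) (d c)
      via-c : ∀ T → inCluster ν i T ≡ true → d′ (inj₂ S₀) (inj₂ T) ≤ℚ ecc + ecc
      via-c T T∈i = ≤-trans (d′-stars≤starW+starW sp S₀ T c)
        (+-mono-≤ (starW≤eccentricity (trans (νσ≡μ p₀) μp₀≡i) c)
                  (starW≤eccentricity (inCluster⇒≡ ν T∈i) c))

lemma2 : ∀ {n m k κ : ℕ} (t : ℕ)
    (red : Fin n → Bool) (d : Fin n → Fin n → ℚ) → IsMetric d →
    1 ≤ k → 1 ≤ t →
    (h : Fin n → Fin n → Bool) → IsMinCostDCS d red t h →
    (cstar : Fin n → Fin k) → IsOptimalFair d red t k cstar →
    (μ : Fin n → Fin κ) → IsMerged cstar h μ →
    (σ : Fin n → Fin m) → IsStarEnum h σ →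
    (d′ : GraphG′.V′ d σ → GraphG′.V′ d σ → ℚ) → GraphG′.IsShortestPath d σ d′ →
    (ν : Fin m → Fin κ) → (∀ p → ν (σ p) ≡ μ p) →
    cost (λ S T → d′ (inj₂ S) (inj₂ T)) ν ≤ℚ ((+ 2 / 1) * cost d μ)
lemma2 {κ = κ} _ _ d _ _ _ _ _ _ _ μ (_ , μ-surjective) σ _ d′ sp ν νσ≡μ =
  subst (_ ≤ℚ_) (sumℚ-*-distribˡ κ (+ 2 / 1) (λ i → radius d (inCluster μ i)))
    (sumℚ-mono-≤ κ λ i →
      radius-stars≤2*radius d σ νσ≡μ sp (proj₂ (μ-surjective i)))
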